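{- For every natural number $n\geq 2$, \[ \varphi^2(n)\big(\psi(n)+\sigma(n)\big)+\psi^2(n)\big(\varphi(n)+\sigma(n)\big)+\sigma^2(n)\big(\varphi(n)+\psi(n)\big)\geq 6n^3+6n^2+2n+2. \]
   Context: For a natural number $n$, $\varphi(n)$ is Euler's totient function (the number of positive integers not exceeding $n$ that are coprime to $n$). For $n=p_1^{a_1}\cdots p_k^{a_k}$ (distinct primes $p_i$, $a_i\geq1$), the Dedekind function is $\psi(n)=\prod_{i=1}^k p_i^{a_i-1}(p_i+1)$, with $\psi(1)=1$. $\sigma(n)$ denotes the sum of the positive divisors of $n$. -}

module Defs where

open import Data.Nat using (ℕ; zero; suc; _+_; _*_; _/_)
open import Data.Nat.Properties using (_≟_)
open import Data.Nat.Coprimality using (coprime?)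
open import Data.Nat.Divisibility using (_∣?_)
open import Data.Nat.Primality using (prime?)
open import Data.Nat.ListAction using (sum; product)
open import Data.List using (List; filter; map; length; applyUpTo)
open import Relation.Nullary.Decidable using (_×-dec_)

range1 : ℕ → List ℕ
range1 n = applyUpTo suc n

divisors : ℕ → List ℕ
divisors n = filter (λ d → d ∣? n) (range1 n)

primeDivisors : ℕ → List ℕ
primeDivisors n = filter (λ p → prime? p ×-dec (p ∣? n)) (range1 n)

φ : ℕ → ℕ
φ n = length (filter (λ k → coprime? k n) (range1 n))

σ : ℕ → ℕ
σ n = sum (divisors n)

-- Dedekind psi: ∏ p^(a-1)(p+1) = n · ∏_{p ∣ n} (p+1) / ∏_{p ∣ n} p  (exact division)
ψ : ℕ → ℕ
ψ n = (n * product (map suc (primeDivisors n))) / suc (product (primeDivisors n) Data.Nat.∸ 1)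

-- For n ≥ 2 put a = φ n, b = ψ n, c = σ n and T = Σ_{p ∣ n prime} ⌊n/p⌋. Every k ≤ n not
-- coprime to n is a multiple of some prime divisor of n, so n ≤ a + T; and
-- ψ n = n ∏_{p ∣ n} (1 + 1/p) ≥ n (1 + Σ 1/p) ≥ n + T. As a < n this forces T ≥ 1, hence
-- b > n and a + b ≥ 2n, while c > n because 1 and n divide n. The symmetric sum
-- Σ a²b = a²(b + c) + b²(a + c) + c²(a + b) is monotone, so it suffices to bound it at a point
-- with a + b = 2n, b = n + 1 + x, c = n + 1, where it equals the right-hand side plus 2x(x + 2);
-- equality holds at (n - 1, n + 1, n + 1).
module Submission where

open import Defs
open import Data.Nat
  using (ℕ; zero; suc; pred; _+_; _*_; _^_; _∸_; _/_; _≤_; _<_; _≤?_; s≤s; z≤n; z<s; NonZero; ≢-nonZero⁻¹; >-nonZero; >-nonZero⁻¹)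
open import Data.Nat.Properties
open import Data.Nat.DivMod using (m*n/n≡m; /-monoˡ-≤)
open import Data.Nat.Divisibility using (_∣_; _∣?_; divides; ∣-refl; ∣-trans; ∣⇒≤; 1∣_; m∣m*n)
open import Data.Nat.GCD using (gcd; gcd[m,n]∣m; gcd[m,n]∣n; gcd[m,n]≢0)
open import Data.Nat.Coprimality using (Coprime; coprime?; gcd≡1⇒coprime)
open import Data.Nat.Primality using (Prime; prime?; ¬prime[0]; prime⇒nonZero; productOfPrimes≢0)
open import Data.Nat.Primality.Factorisation using (factorise)
open import Data.Nat.ListAction using (sum; product)
open import Data.Nat.ListAction.Properties using (sum-++)
open import Data.Nat.Tactic.RingSolver using (solve-∀)
open import Data.List using (List; []; _∷_; _++_; [_]; filter; length; map)
open import Data.List.Properties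
  using (applyUpTo-∷ʳ; length-applyUpTo; length-++; ++-identityʳ; filter-++; filter-accept; filter-reject; length-filter)
open import Data.List.Membership.Propositional using (_∈_)
open import Data.List.Membership.Propositional.Properties using (∈-applyUpTo⁺; ∈-filter⁺)
open import Data.List.Relation.Unary.All as All using (All; []; _∷_)
open import Data.List.Relation.Unary.All.Properties using (all-filter)
open import Data.List.Relation.Unary.Any using (here; there)
open import Data.Product using (∃-syntax; _×_; _,_; proj₁)
open import Data.Sum using (_⊎_; inj₁; inj₂)
open import Relation.Binary.PropositionalEquality using (_≡_; refl; sym; trans; cong; subst; module ≡-Reasoning)
open import Relation.Nullary using (¬_; yes; no)
open import Relation.Nullary.Decidable using (_×-dec_)
open import Relation.Nullary.Negation using (contradiction)
open import Relation.Unary using (Pred; Decidable)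
open import Function using (_∘′_)

Σa²b : ℕ → ℕ → ℕ → ℕ
Σa²b a b c = a ^ 2 * (b + c) + b ^ 2 * (a + c) + c ^ 2 * (a + b)

bound : ℕ → ℕ
bound n = 6 * n ^ 3 + 6 * n ^ 2 + 2 * n + 2

Σa²b-mono-≤ : ∀ {a a′ b b′ c c′} → a ≤ a′ → b ≤ b′ → c ≤ c′ → Σa²b a b c ≤ Σa²b a′ b′ c′
Σa²b-mono-≤ a≤a′ b≤b′ c≤c′ = +-mono-≤ (+-mono-≤ (term a≤a′ b≤b′ c≤c′) (term b≤b′ a≤a′ c≤c′)) (term c≤c′ a≤a′ b≤b′)
  where
    term : ∀ {x x′ y y′ z z′} → x ≤ x′ → y ≤ y′ → z ≤ z′ → x ^ 2 * (y + z) ≤ x′ ^ 2 * (y′ + z′)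
    term x≤x′ y≤y′ z≤z′ = *-mono-≤ (^-monoˡ-≤ 2 x≤x′) (+-mono-≤ y≤y′ z≤z′)

Σa²b-balanced : ∀ v x → let n = v + x + 1 in Σa²b v (suc n + x) (suc n) ≡ bound n + 2 * x * (x + 2)
Σa²b-balanced = expanded
  where
    -- The ring solver does not recognise ℕ's _^_, so the powers are unfolded by hand.
    expanded : ∀ v x → let n = v + x + 1; b = suc n + x; c = suc n in
      v * (v * 1) * (b + c) + b * (b * 1) * (v + c) + c * (c * 1) * (v + b)
        ≡ 6 * (n * (n * (n * 1))) + 6 * (n * (n * 1)) + 2 * n + 2 + 2 * x * (x + 2)
    expanded = solve-∀

a+[1+n+x]≡2n⇒a+x+1≡n : ∀ {n a x} → a + (suc n + x) ≡ 2 * n → a + x + 1 ≡ n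
a+[1+n+x]≡2n⇒a+x+1≡n {n} {a} {x} eq = +-cancelˡ-≡ n _ _ (begin
  n + (a + x + 1)   ≡⟨ rearrange n a x ⟩
  a + (suc n + x)   ≡⟨ eq ⟩
  2 * n             ≡⟨ cong (n +_) (+-identityʳ n) ⟩
  n + n             ∎)
  where
    open ≡-Reasoning
    rearrange : ∀ n a x → n + (a + x + 1) ≡ a + (suc n + x)
    rearrange = solve-∀

bound≤Σa²b-balanced : ∀ {n a b} → a + b ≡ 2 * n → n < b → bound n ≤ Σa²b a b (suc n)
bound≤Σa²b-balanced {n} {a} a+b≡2n n<b with m≤n⇒∃[o]m+o≡n n<b
... | x , refl with a+[1+n+x]≡2n⇒a+x+1≡n {n} {a} {x} a+b≡2n
...   | refl = ≤-trans (m≤m+n (bound n) _) (≤-reflexive (sym (Σa²b-balanced a x)))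

bound≤Σa²b : ∀ {n a b c} → 1 ≤ n → 2 * n ≤ a + b → n < b → n < c → bound n ≤ Σa²b a b c
bound≤Σa²b {n} {a} {b} 1≤n 2n≤a+b n<b n<c with 2 * n ≤? b
... | yes 2n≤b = ≤-trans (bound≤Σa²b-balanced {a = 0} refl n<2n) (Σa²b-mono-≤ z≤n 2n≤b n<c)
  where
    n<2n : n < 2 * n
    n<2n = m<m+n n (≤-trans 1≤n (≤-reflexive (sym (+-identityʳ n))))
... | no 2n≰b = ≤-trans (bound≤Σa²b-balanced (m∸n+n≡m (<⇒≤ (≰⇒> 2n≰b))) n<b) (Σa²b-mono-≤ 2n∸b≤a ≤-refl n<c)
  where
    2n∸b≤a : 2 * n ∸ b ≤ a
    2n∸b≤a = m≤n+o⇒m∸n≤o (2 * n) b (≤-trans 2n≤a+b (≤-reflexive (+-comm a b)))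

range1-suc : ∀ n → range1 (suc n) ≡ range1 n ++ [ suc n ]
range1-suc n = sym (applyUpTo-∷ʳ suc n)

module _ {ℓ} {P : Pred ℕ ℓ} (P? : Decidable P) where

  filter-range1-suc⁺ : ∀ {n} → P (suc n) → filter P? (range1 (suc n)) ≡ filter P? (range1 n) ++ [ suc n ]
  filter-range1-suc⁺ {n} P[1+n] = begin
    filter P? (range1 (suc n))                  ≡⟨ cong (filter P?) (range1-suc n) ⟩
    filter P? (range1 n ++ [ suc n ])           ≡⟨ filter-++ P? (range1 n) [ suc n ] ⟩
    filter P? (range1 n) ++ filter P? [ suc n ] ≡⟨ cong (filter P? (range1 n) ++_) (filter-accept P? P[1+n]) ⟩
    filter P? (range1 n) ++ [ suc n ]           ∎
    where open ≡-Reasoning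

  filter-range1-suc⁻ : ∀ {n} → ¬ P (suc n) → filter P? (range1 (suc n)) ≡ filter P? (range1 n)
  filter-range1-suc⁻ {n} ¬P[1+n] = begin
    filter P? (range1 (suc n))                  ≡⟨ cong (filter P?) (range1-suc n) ⟩
    filter P? (range1 n ++ [ suc n ])           ≡⟨ filter-++ P? (range1 n) [ suc n ] ⟩
    filter P? (range1 n) ++ filter P? [ suc n ] ≡⟨ cong (filter P? (range1 n) ++_) (filter-reject P? ¬P[1+n]) ⟩
    filter P? (range1 n) ++ []                  ≡⟨ ++-identityʳ _ ⟩
    filter P? (range1 n)                        ∎
    where open ≡-Reasoning

φ<n : ∀ {n} → 2 ≤ n → φ n < n
φ<n {n@(suc (suc k))} (s≤s (s≤s _)) = begin-strict
  φ n                                        ≡⟨ cong length (filter-range1-suc⁻ coprime?ₙ ¬coprime[n,n]) ⟩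
  length (filter coprime?ₙ (range1 (suc k))) ≤⟨ length-filter coprime?ₙ (range1 (suc k)) ⟩
  length (range1 (suc k))                    ≡⟨ length-applyUpTo suc (suc k) ⟩
  suc k                                      <⟨ n<1+n (suc k) ⟩
  n                                          ∎
  where
    open ≤-Reasoning
    coprime?ₙ : Decidable (λ j → Coprime j n)
    coprime?ₙ j = coprime? j n
    ¬coprime[n,n] : ¬ Coprime n n
    ¬coprime[n,n] cop with () ← cop (∣-refl , ∣-refl)

n<σ : ∀ {n} → 2 ≤ n → n < σ n
n<σ {n@(suc (suc k))} (s≤s (s≤s _)) = begin-strict
  n                        <⟨ m<n+m n 0<sum ⟩
  sum ds + n               ≡⟨ cong (sum ds +_) (+-identityʳ n) ⟨
  sum ds + sum [ n ]       ≡⟨ sum-++ ds [ n ] ⟨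
  sum (ds ++ [ n ])        ≡⟨ cong sum (filter-range1-suc⁺ (_∣? n) ∣-refl) ⟨
  σ n                      ∎
  where
    open ≤-Reasoning
    ds : List ℕ
    ds = filter (_∣? n) (range1 (suc k))
    0<sum : 0 < sum ds
    0<sum = subst (λ xs → 0 < sum xs) (sym (filter-accept (_∣? n) (1∣ n))) (s≤s z≤n)

multiples : ℕ → List ℕ → ℕ
multiples p xs = length (filter (p ∣?_) xs)

multiples-∷-∣ : ∀ {p x} xs → p ∣ x → multiples p (x ∷ xs) ≡ suc (multiples p xs)
multiples-∷-∣ {p} xs p∣x = cong length (filter-accept (p ∣?_) p∣x)

multiples-∷-≤ : ∀ p x xs → multiples p xs ≤ multiples p (x ∷ xs)
multiples-∷-≤ p x xs with p ∣? x
... | yes _ = n≤1+n (multiples p xs)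
... | no _  = ≤-refl

IsQuotient : ℕ → ℕ → ℕ → Set
IsQuotient n p q = q * p ≤ n × n < suc q * p

isQuotient-suc-∣ : ∀ {n p q} .{{_ : NonZero p}} → IsQuotient n p q → p ∣ suc n → IsQuotient (suc n) p (suc q)
isQuotient-suc-∣ {n} {p} {q} (qp≤n , n<[1+q]p) (divides d 1+n≡dp) =
  ≤-reflexive (sym 1+n≡[1+q]p) , subst (_< p + suc q * p) (sym 1+n≡[1+q]p) (m<n+m (suc q * p) (>-nonZero⁻¹ p))
  where
    d≡1+q : d ≡ suc q
    d≡1+q = ≤-antisym (*-cancelʳ-≤ d (suc q) p (subst (_≤ suc q * p) 1+n≡dp n<[1+q]p))
                      (*-cancelʳ-< p q d (subst (q * p <_) 1+n≡dp (s≤s qp≤n)))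
    1+n≡[1+q]p : suc n ≡ suc q * p
    1+n≡[1+q]p = trans 1+n≡dp (cong (_* p) d≡1+q)

isQuotient-suc-∤ : ∀ {n p q} → IsQuotient n p q → ¬ p ∣ suc n → IsQuotient (suc n) p q
isQuotient-suc-∤ {q = q} (qp≤n , n<[1+q]p) p∤1+n = m≤n⇒m≤1+n qp≤n , ≤∧≢⇒< n<[1+q]p (p∤1+n ∘′ divides (suc q))

multiples-range1-suc-∣ : ∀ {p n} → p ∣ suc n → multiples p (range1 (suc n)) ≡ suc (multiples p (range1 n))
multiples-range1-suc-∣ {p} {n} p∣1+n = begin
  multiples p (range1 (suc n))                    ≡⟨ cong length (filter-range1-suc⁺ (p ∣?_) p∣1+n) ⟩
  length (filter (p ∣?_) (range1 n) ++ [ suc n ]) ≡⟨ length-++ (filter (p ∣?_) (range1 n)) ⟩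
  multiples p (range1 n) + 1                      ≡⟨ +-comm _ 1 ⟩
  suc (multiples p (range1 n))                    ∎
  where open ≡-Reasoning

multiples-range1-suc-∤ : ∀ {p n} → ¬ p ∣ suc n → multiples p (range1 (suc n)) ≡ multiples p (range1 n)
multiples-range1-suc-∤ {p} p∤1+n = cong length (filter-range1-suc⁻ (p ∣?_) p∤1+n)

multiples-range1-isQuotient : ∀ p .{{_ : NonZero p}} n → IsQuotient n p (multiples p (range1 n))
multiples-range1-isQuotient p zero    = z≤n , subst (0 <_) (sym (*-identityˡ p)) (>-nonZero⁻¹ p)
multiples-range1-isQuotient p (suc n) with p ∣? suc n
... | yes p∣1+n = subst (IsQuotient (suc n) p) (sym (multiples-range1-suc-∣ p∣1+n))
                        (isQuotient-suc-∣ {q = multiples p (range1 n)} (multiples-range1-isQuotient p n) p∣1+n)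
... | no p∤1+n  = subst (IsQuotient (suc n) p) (sym (multiples-range1-suc-∤ p∤1+n))
                        (isQuotient-suc-∤ {q = multiples p (range1 n)} (multiples-range1-isQuotient p n) p∤1+n)

multiplesSum : List ℕ → List ℕ → ℕ
multiplesSum ps xs = sum (map (λ p → multiples p xs) ps)

multiplesSum-∷-≤ : ∀ ps x xs → multiplesSum ps xs ≤ multiplesSum ps (x ∷ xs)
multiplesSum-∷-≤ []       x xs = z≤n
multiplesSum-∷-≤ (p ∷ ps) x xs = +-mono-≤ (multiples-∷-≤ p x xs) (multiplesSum-∷-≤ ps x xs)

multiplesSum-∷-< : ∀ {p ps x} xs → p ∈ ps → p ∣ x → multiplesSum ps xs < multiplesSum ps (x ∷ xs)
multiplesSum-∷-< {ps = _ ∷ ps} xs (here refl) p∣x =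
  +-mono-<-≤ (≤-reflexive (sym (multiples-∷-∣ xs p∣x))) (multiplesSum-∷-≤ ps _ xs)
multiplesSum-∷-< {ps = q ∷ _} {x} xs (there p∈ps) p∣x =
  +-mono-≤-< (multiples-∷-≤ q x xs) (multiplesSum-∷-< xs p∈ps p∣x)

length≤filter+multiplesSum : ∀ {ℓ} {P : Pred ℕ ℓ} (P? : Decidable P) ps →
  (∀ x → P x ⊎ ∃[ p ] p ∈ ps × p ∣ x) →
  ∀ xs → length xs ≤ length (filter P? xs) + multiplesSum ps xs
length≤filter+multiplesSum P? ps cover []       = z≤n
length≤filter+multiplesSum P? ps cover (x ∷ xs) with P? x | cover x
... | yes _ | _ =
  s≤s (≤-trans (length≤filter+multiplesSum P? ps cover xs) (+-monoʳ-≤ _ (multiplesSum-∷-≤ ps x xs)))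
... | no ¬Px | inj₁ Px = contradiction Px ¬Px
... | no ¬Px | inj₂ (p , p∈ps , p∣x) = begin
  suc (length xs)                                    ≤⟨ s≤s (length≤filter+multiplesSum P? ps cover xs) ⟩
  suc (length (filter P? xs) + multiplesSum ps xs)   ≡⟨ +-suc _ _ ⟨
  length (filter P? xs) + suc (multiplesSum ps xs)   ≤⟨ +-monoʳ-≤ _ (multiplesSum-∷-< xs p∈ps p∣x) ⟩
  length (filter P? xs) + multiplesSum ps (x ∷ xs)   ∎
  where open ≤-Reasoning

prime-divisor : ∀ {m} → 2 ≤ m → ∃[ p ] Prime p × p ∣ m
prime-divisor {m@(suc (suc _))} (s≤s (s≤s _)) with factorise m
... | record { factors = p ∷ ps ; isFactorisation = eq ; factorsPrime = pr ∷ _ } =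
  p , pr , subst (p ∣_) (sym eq) (m∣m*n (product ps))

¬coprime⇒common-prime-divisor : ∀ {k n} .{{_ : NonZero n}} → ¬ Coprime k n → ∃[ p ] Prime p × p ∣ k × p ∣ n
¬coprime⇒common-prime-divisor {k} {n} ¬cop =
  let p , pr , p∣gcd = prime-divisor 2≤gcd
  in  p , pr , ∣-trans p∣gcd (gcd[m,n]∣m k n) , ∣-trans p∣gcd (gcd[m,n]∣n k n)
  where
    2≤gcd : 2 ≤ gcd k n
    2≤gcd with gcd k n | gcd[m,n]≢0 k n (inj₂ (≢-nonZero⁻¹ n)) | gcd≡1⇒coprime {k} {n}
    ... | 0           | gcd≢0 | _          = contradiction refl gcd≢0
    ... | 1           | _     | gcd≡1⇒cop = contradiction (λ {i} → gcd≡1⇒cop refl {i}) ¬cop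
    ... | suc (suc _) | _     | _          = s≤s (s≤s z≤n)

∈-primeDivisors⁺ : ∀ {n p} .{{_ : NonZero n}} → Prime p → p ∣ n → p ∈ primeDivisors n
∈-primeDivisors⁺ {p = zero}      pr  _   = contradiction pr ¬prime[0]
∈-primeDivisors⁺ {n} {p = suc _} pr p∣n =
  ∈-filter⁺ (λ q → prime? q ×-dec (q ∣? n)) (∈-applyUpTo⁺ suc (∣⇒≤ p∣n)) (pr , p∣n)

primeDivisors-prime : ∀ n → All Prime (primeDivisors n)
primeDivisors-prime n = All.map proj₁ (all-filter (λ q → prime? q ×-dec (q ∣? n)) (range1 n))

coprime⊎prime-divisor : ∀ n .{{_ : NonZero n}} k → Coprime k n ⊎ ∃[ p ] p ∈ primeDivisors n × p ∣ k
coprime⊎prime-divisor n k with coprime? k n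
... | yes cop = inj₁ cop
... | no ¬cop with p , pr , p∣k , p∣n ← ¬coprime⇒common-prime-divisor ¬cop =
  inj₂ (p , ∈-primeDivisors⁺ pr p∣n , p∣k)

primeMultiples : ℕ → ℕ
primeMultiples n = multiplesSum (primeDivisors n) (range1 n)

n≤φ+primeMultiples : ∀ n .{{_ : NonZero n}} → n ≤ φ n + primeMultiples n
n≤φ+primeMultiples n = subst (_≤ φ n + primeMultiples n) (length-applyUpTo suc n)
  (length≤filter+multiplesSum (λ k → coprime? k n) (primeDivisors n) (coprime⊎prime-divisor n) (range1 n))

m*n≤o⇒m≤o/n : ∀ m n {o} .{{_ : NonZero n}} → m * n ≤ o → m ≤ o / n
m*n≤o⇒m≤o/n m n {o} m*n≤o = subst (_≤ o / n) (m*n/n≡m m n) (/-monoˡ-≤ n m*n≤o)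

product≤product-suc : ∀ ps → product ps ≤ product (map suc ps)
product≤product-suc []       = ≤-refl
product≤product-suc (p ∷ ps) = *-mono-≤ (n≤1+n p) (product≤product-suc ps)

[n+sum]*product≤n*product-suc : ∀ n (f : ℕ → ℕ) ps → All (λ p → f p * p ≤ n) ps →
  (n + sum (map f ps)) * product ps ≤ n * product (map suc ps)
[n+sum]*product≤n*product-suc n f []       []              = ≤-reflexive (cong (_* 1) (+-identityʳ n))
[n+sum]*product≤n*product-suc n f (p ∷ ps) (fp*p≤n ∷ bounds) = begin
  (n + (f p + s)) * (p * P)    ≡⟨ expand n (f p) s p P ⟩
  p * ((n + s) * P) + f p * p * P
    ≤⟨ +-mono-≤ (*-monoʳ-≤ p ([n+sum]*product≤n*product-suc n f ps bounds))
                (*-mono-≤ fp*p≤n (product≤product-suc ps)) ⟩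
  p * (n * Q) + n * Q          ≡⟨ collect n p Q ⟩
  n * ((1 + p) * Q)            ∎
  where
    open ≤-Reasoning
    s = sum (map f ps)
    P = product ps
    Q = product (map suc ps)
    expand : ∀ n fp s p P → (n + (fp + s)) * (p * P) ≡ p * ((n + s) * P) + fp * p * P
    expand = solve-∀
    collect : ∀ n p Q → p * (n * Q) + n * Q ≡ n * ((1 + p) * Q)
    collect = solve-∀

-- ψ n divides by suc (P ∸ 1), where P = product (primeDivisors n); this is P because P ≠ 0.
n+primeMultiples≤ψ : ∀ n → n + primeMultiples n ≤ ψ n
n+primeMultiples≤ψ n = m*n≤o⇒m≤o/n (n + primeMultiples n) (suc (pred P))
  (subst (λ d → (n + primeMultiples n) * d ≤ n * product (map suc ps)) (sym (suc-pred P))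
    ([n+sum]*product≤n*product-suc n (λ p → multiples p (range1 n)) ps multiples*p≤n))
  where
    ps = primeDivisors n
    P = product ps
    instance
      P≢0 : NonZero P
      P≢0 = productOfPrimes≢0 (primeDivisors-prime n)
    multiples*p≤n : All (λ p → multiples p (range1 n) * p ≤ n) ps
    multiples*p≤n = All.map (λ pr → proj₁ (multiples-range1-isQuotient _ {{prime⇒nonZero pr}} n)) (primeDivisors-prime n)

n<ψ : ∀ {n} → 2 ≤ n → n < ψ n
n<ψ {n} 2≤n = begin-strict
  n                       <⟨ m<m+n n 0<primeMultiples ⟩
  n + primeMultiples n    ≤⟨ n+primeMultiples≤ψ n ⟩
  ψ n                     ∎
  where
    open ≤-Reasoning
    instance
      n≢0 : NonZero n
      n≢0 = >-nonZero (<-trans z<s 2≤n)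
    0<primeMultiples : 0 < primeMultiples n
    0<primeMultiples = +-cancelˡ-< (φ n) 0 (primeMultiples n)
      (subst (_< φ n + primeMultiples n) (sym (+-identityʳ (φ n))) (<-≤-trans (φ<n 2≤n) (n≤φ+primeMultiples n)))

2n≤φ+ψ : ∀ n .{{_ : NonZero n}} → 2 * n ≤ φ n + ψ n
2n≤φ+ψ n = begin
  2 * n                        ≡⟨ cong (n +_) (+-identityʳ n) ⟩
  n + n                        ≤⟨ +-monoˡ-≤ n (n≤φ+primeMultiples n) ⟩
  φ n + primeMultiples n + n   ≡⟨ +-assoc (φ n) _ n ⟩
  φ n + (primeMultiples n + n) ≡⟨ cong (φ n +_) (+-comm _ n) ⟩
  φ n + (n + primeMultiples n) ≤⟨ +-monoʳ-≤ (φ n) (n+primeMultiples≤ψ n) ⟩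
  φ n + ψ n                    ∎
  where open ≤-Reasoning

theorem4 : (n : ℕ) → 2 ≤ n →
    6 * n ^ 3 + 6 * n ^ 2 + 2 * n + 2
      ≤ φ n ^ 2 * (ψ n + σ n) + ψ n ^ 2 * (φ n + σ n) + σ n ^ 2 * (φ n + ψ n)
theorem4 n 2≤n = bound≤Σa²b 1≤n (2n≤φ+ψ n) (n<ψ 2≤n) (n<σ 2≤n)
  where
    1≤n : 1 ≤ n
    1≤n = <-trans z<s 2≤n
    instance
      n≢0 : NonZero n
      n≢0 = >-nonZero 1≤n
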